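{- Let $k\ge99$ be odd. There exists a degree-$4$ multilinear polynomial $\mathcal{Q}:\{ -1,1\}^k\to\mathbb{R}$ that $\tfrac{1}{225}$-separates $\mathrm{Thr}_k^{ -\frac12\sqrt k}$. Consequently, $\mathrm{Thr}_k^{ -\frac12\sqrt k}$ is $\tfrac{1}{225}$-far from supporting a $4$-wise uniform distribution.
   Context: For odd $k$ and real $\theta$, $\mathrm{Thr}_k^\theta:\{ -1,1\}^k\to\{0,1\}$ is $1$ on $z$ iff $\sum_{i=1}^kz_i\ge\theta$. For $P:\{ -1,1\}^k\to\{0,1\}$ and $0<\delta<1$, a multilinear polynomial $Q(z)=\sum_S\widehat Q(S)\prod_{i\in S}z_i$ $\delta$-separates $P$ if $Q(z)\ge\delta-1$ for all $z$, $Q(z)\ge\delta$ for all $z\in P^{ -1}(1)$, and $\widehat Q(\emptyset)=0$. A distribution on $\{ -1,1\}^k$ is $4$-wise uniform if every marginal on $4$ coordinates is uniform; $P$ is $\delta$-far from supporting one if every $4$-wise uniform distribution puts mass at least $\delta$ on $P^{ -1}(0)$.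
   Formalization: The 4-wise uniform distributions in the farness claim have only rational probabilities, and the coefficients of $\mathcal{Q}$ are taken in ℚ rather than ℝ. -}

module Defs where

open import Data.Bool using (Bool; true; false; _∨_)
open import Data.Nat as ℕ using (ℕ; zero; suc)
open import Data.Integer as ℤ using (ℤ; +_)
open import Data.Rational as ℚ using (ℚ; 0ℚ; 1ℚ; _+_; _*_; _-_; _≤_)
open import Data.Sign as Sign using (Sign)
open import Data.Vec using (Vec; []; _∷_)
open import Data.List as List using (List; []; _∷_; concatMap; map; filter)
open import Data.Fin.Subset using (Subset; ∣_∣)
open import Relation.Binary.PropositionalEquality using (_≡_)
open import Relation.Nullary.Decidable using (does)

-- The cube {-1,1}^k: a point is a Vec Sign k (Sign.+ ↦ 1, Sign.- ↦ -1).

Point : ℕ → Set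
Point k = Vec Sign k

allVecs : {A : Set} → List A → (n : ℕ) → List (Vec A n)
allVecs as zero    = [] ∷ []
allVecs as (suc n) = concatMap (λ a → map (a ∷_) (allVecs as n)) as

allPoints : (k : ℕ) → List (Point k)
allPoints = allVecs (Sign.+ ∷ Sign.- ∷ [])

allSubsets : (k : ℕ) → List (Subset k)
allSubsets = allVecs (true ∷ false ∷ [])

sumℚ : List ℚ → ℚ
sumℚ = List.foldr _+_ 0ℚ

signℤ : Sign → ℤ
signℤ Sign.+ = + 1
signℤ Sign.- = ℤ.- (+ 1)

signℚ : Sign → ℚ
signℚ Sign.+ = 1ℚ
signℚ Sign.- = ℚ.- 1ℚ

-- Multilinear polynomials: Q(z) = Σ_S Q̂(S) ∏_{i∈S} z_i,
-- represented by the coefficient function S ↦ Q̂(S) (S ⊆ [k]).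

MultilinPoly : ℕ → Set
MultilinPoly k = Subset k → ℚ

monomial : {k : ℕ} → Subset k → Point k → ℚ
monomial []          []      = 1ℚ
monomial (true  ∷ S) (z ∷ zs) = signℚ z * monomial S zs
monomial (false ∷ S) (z ∷ zs) = monomial S zs

eval : {k : ℕ} → MultilinPoly k → Point k → ℚ
eval {k} Q z = sumℚ (map (λ S → Q S * monomial S z) (allSubsets k))

DegreeAtMost : {k : ℕ} → ℕ → MultilinPoly k → Set
DegreeAtMost d Q = ∀ S → d ℕ.< ∣ S ∣ → Q S ≡ 0ℚ

emptySet : (k : ℕ) → Subset k
emptySet zero    = []
emptySet (suc k) = false ∷ emptySet k

Separates : {k : ℕ} → ℚ → (Point k → Bool) → MultilinPoly k → Set
Separates {k} δ P Q =
    (∀ z → δ - 1ℚ ≤ eval Q z)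
  × (∀ z → P z ≡ true → δ ≤ eval Q z)
  × (Q (emptySet k) ≡ 0ℚ)
  where open import Data.Product using (_×_)

record Distribution (k : ℕ) : Set where
  field
    prob    : Point k → ℚ
    nonneg  : ∀ z → 0ℚ ≤ prob z
    total   : sumℚ (map prob (allPoints k)) ≡ 1ℚ
open Distribution public

mass : {k : ℕ} → Distribution k → (Point k → Bool) → ℚ
mass {k} μ E = sumℚ (map (prob μ) (filter (λ z → Data.Bool._≟_ (E z) true) (allPoints k)))
  where import Data.Bool

agreeOn : {k : ℕ} → Subset k → Point k → Point k → Bool
agreeOn []          []       []       = true
agreeOn (true  ∷ T) (z ∷ zs) (y ∷ ys) = does (z Sign.≟ y) Data.Bool.∧ agreeOn T zs ys
  where import Data.Bool
agreeOn (false ∷ T) (z ∷ zs) (y ∷ ys) = agreeOn T zs ys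

FourWiseUniform : {k : ℕ} → Distribution k → Set
FourWiseUniform {k} μ =
  ∀ (T : Subset k) → ∣ T ∣ ≡ 4 → ∀ (y : Point k) →
    mass μ (agreeOn T y) ≡ (+ 1 ℚ./ 16)

FarFromFourWise : {k : ℕ} → ℚ → (Point k → Bool) → Set
FarFromFourWise {k} δ P =
  ∀ (μ : Distribution k) → FourWiseUniform μ →
    δ ≤ mass μ (λ z → Data.Bool.not (P z))
  where import Data.Bool

-- Thr_k^θ with θ = -(1/2)√k :  Thr(z) = 1  iff  Σ z_i ≥ -(1/2)√k.
-- For an integer s:  s ≥ -√k/2  ⇔  -2s ≤ √k  ⇔  (s ≥ 0) ∨ ((2s)² ≤ k).

sumSigns : {k : ℕ} → Point k → ℤ
sumSigns []       = + 0
sumSigns (z ∷ zs) = signℤ z ℤ.+ sumSigns zs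

geNegHalfSqrt : ℕ → ℤ → Bool
geNegHalfSqrt k s = (+ 0 ℤ.≤ᵇ s) ∨ (((+ 2) ℤ.* s) ℤ.* ((+ 2) ℤ.* s) ℤ.≤ᵇ + k)

ThrNegHalfSqrt : (k : ℕ) → Point k → Bool
ThrNegHalfSqrt k z = geNegHalfSqrt k (sumSigns z)

module Submission where

-- The separating polynomial is symmetric: Q(z) = p(r Σzᵢ) minus its mean, for an explicit quartic
-- p and a rational r ≈ 1/√k, so expanding p(r s) in the elementary symmetric polynomials e₁, …, e₄
-- shows that Q has degree 4 and no constant term. Since 1 ≤ r²k ≤ 101/100, Q(z) ≥ H(r Σzᵢ) − 1/500
-- for H = p minus its Gaussian mean, and sum-of-squares certificates bound H below by −99/100
-- everywhere and by 1/100 on x ≥ −503/1000, a half-line containing r Σzᵢ whenever Σzᵢ ≥ −√k/2.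
-- Farness then follows by averaging: every monomial of degree 1 to 4 has mean zero under a 4-wise
-- uniform μ, so E_μ Q = 0, while Q ≥ 1/225 − 1[Thr = 0] pointwise.

module Separation where
  open import Defs
  open import Algebra.Bundles.Raw using (RawRing)
  open import Data.Bool as Bool using (Bool; true; false; not; T)
  open import Data.Empty using (⊥; ⊥-elim)
  open import Data.Fin.Subset using (Subset; ∣_∣)
  open import Data.Fin.Subset.Properties using (∣p∣≤n)
  open import Data.Integer as ℤ using (ℤ; +_)
  import Data.Integer.Properties as ℤP
  open import Data.List using (List; []; _∷_; _++_; map; filter; concatMap)
  open import Data.Nat as ℕ using (ℕ; zero; suc; z≤n; s≤s)
  import Data.Nat.Properties as ℕP
  import Data.Nat.Tactic.RingSolver as ℕ-Ring
  open import Data.Product using (Σ; _×_; _,_)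
  open import Data.Rational as ℚ using (ℚ; 0ℚ; 1ℚ; _+_; _*_; _-_; -_; _≤_; _/_; ½; 1/_)
  open import Data.Rational.Literals using (fromℤ)
  import Data.Rational.Properties as ℚP
  open import Data.Rational.Solver using (module +-*-Solver)
  open import Data.Sign as Sign using (Sign)
  open import Data.Sum using (_⊎_; inj₁; inj₂; [_,_]′)
  open import Data.Unit using (tt)
  open import Data.Vec using (Vec; []; _∷_)
  open import Data.Vec.Relation.Binary.Pointwise.Inductive using (Pointwise; []; _∷_)
  open import Function using (id; _∘_)
  open import Level using (0ℓ)
  open import Relation.Binary.PropositionalEquality
  open import Relation.Nullary using (yes; no)

  open +-*-Solver

  ∑ : {A : Set} → List A → (A → ℚ) → ℚ
  ∑ xs f = sumℚ (map f xs)

  indicator : Bool → ℚ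
  indicator true  = 1ℚ
  indicator false = 0ℚ

  module _ {A : Set} where

    ∑-cong : (xs : List A) {f g : A → ℚ} → (∀ x → f x ≡ g x) → ∑ xs f ≡ ∑ xs g
    ∑-cong []       f≗g = refl
    ∑-cong (x ∷ xs) f≗g = cong₂ _+_ (f≗g x) (∑-cong xs f≗g)

    ∑-zero : (xs : List A) {f : A → ℚ} → (∀ x → f x ≡ 0ℚ) → ∑ xs f ≡ 0ℚ
    ∑-zero []       f≗0 = refl
    ∑-zero (x ∷ xs) f≗0 = cong₂ _+_ (f≗0 x) (∑-zero xs f≗0)

    ∑-++ : (xs ys : List A) (f : A → ℚ) → ∑ (xs ++ ys) f ≡ ∑ xs f + ∑ ys f
    ∑-++ []       ys f = sym (ℚP.+-identityˡ _)
    ∑-++ (x ∷ xs) ys f = trans (cong (_+_ (f x)) (∑-++ xs ys f)) (sym (ℚP.+-assoc (f x) _ _))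

    ∑-+ : (xs : List A) (f g : A → ℚ) → ∑ xs (λ x → f x + g x) ≡ ∑ xs f + ∑ xs g
    ∑-+ []       f g = refl
    ∑-+ (x ∷ xs) f g = trans (cong (_+_ (f x + g x)) (∑-+ xs f g))
      (solve 4 (λ a b c d → (a :+ b) :+ (c :+ d) := (a :+ c) :+ (b :+ d)) refl (f x) (g x) (∑ xs f) (∑ xs g))

    ∑-*ˡ : (xs : List A) (c : ℚ) (f : A → ℚ) → ∑ xs (λ x → c * f x) ≡ c * ∑ xs f
    ∑-*ˡ []       c f = sym (ℚP.*-zeroʳ c)
    ∑-*ˡ (x ∷ xs) c f = trans (cong (_+_ (c * f x)) (∑-*ˡ xs c f)) (sym (ℚP.*-distribˡ-+ c (f x) _))

    ∑-mono-≤ : (xs : List A) {f g : A → ℚ} → (∀ x → f x ≤ g x) → ∑ xs f ≤ ∑ xs g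
    ∑-mono-≤ []       f≤g = ℚP.≤-refl
    ∑-mono-≤ (x ∷ xs) f≤g = ℚP.+-mono-≤ (f≤g x) (∑-mono-≤ xs f≤g)

    ∑-filter : (xs : List A) (E : A → Bool) (f : A → ℚ) →
      sumℚ (map f (filter (λ x → E x Bool.≟ true) xs)) ≡ ∑ xs (λ x → f x * indicator (E x))
    ∑-filter []       E f = refl
    ∑-filter (x ∷ xs) E f with E x
    ... | true  = cong₂ _+_ (sym (ℚP.*-identityʳ (f x))) (∑-filter xs E f)
    ... | false = begin
      sumℚ (map f (filter (λ x → E x Bool.≟ true) xs))  ≡⟨ ∑-filter xs E f ⟩
      ∑ xs (λ x → f x * indicator (E x))                 ≡⟨ sym (ℚP.+-identityˡ _) ⟩
      0ℚ + ∑ xs (λ x → f x * indicator (E x))            ≡⟨ cong (_+ _) (sym (ℚP.*-zeroʳ (f x))) ⟩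
      f x * 0ℚ + ∑ xs (λ x → f x * indicator (E x))      ∎
      where open ≡-Reasoning

  ∑-map : {A B : Set} (xs : List A) (g : A → B) (f : B → ℚ) → ∑ (map g xs) f ≡ ∑ xs (f ∘ g)
  ∑-map []       g f = refl
  ∑-map (x ∷ xs) g f = cong (_+_ (f (g x))) (∑-map xs g f)

  ∑-concatMap : {A B : Set} (xs : List A) (g : A → List B) (f : B → ℚ) →
    ∑ (concatMap g xs) f ≡ ∑ xs (λ x → ∑ (g x) f)
  ∑-concatMap []       g f = refl
  ∑-concatMap (x ∷ xs) g f = trans (∑-++ (g x) _ f) (cong (_+_ (∑ (g x) f)) (∑-concatMap xs g f))

  ∑-comm : {A B : Set} (xs : List A) (ys : List B) (h : A → B → ℚ) →
    ∑ xs (λ x → ∑ ys (h x)) ≡ ∑ ys (λ y → ∑ xs (λ x → h x y))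
  ∑-comm []       ys h = sym (∑-zero ys (λ _ → refl))
  ∑-comm (x ∷ xs) ys h = trans (cong (_+_ (∑ ys (h x))) (∑-comm xs ys h))
    (sym (∑-+ ys (h x) (λ y → ∑ xs (λ x′ → h x′ y))))

  ∑-allVecs-suc : {A : Set} (as : List A) (n : ℕ) (f : Vec A (suc n) → ℚ) →
    ∑ (allVecs as (suc n)) f ≡ ∑ as (λ a → ∑ (allVecs as n) (λ v → f (a ∷ v)))
  ∑-allVecs-suc as n f =
    trans (∑-concatMap as _ f) (∑-cong as (λ a → ∑-map (allVecs as n) (a ∷_) f))

  ∑-pair : {A : Set} (a b : A) (f : A → ℚ) → ∑ (a ∷ b ∷ []) f ≡ f a + f b
  ∑-pair a b f = cong (_+_ (f a)) (ℚP.+-identityʳ (f b))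

  ∑-cube-suc : ∀ n (f : Point (suc n) → ℚ) →
    ∑ (allPoints (suc n)) f
      ≡ ∑ (allPoints n) (λ y → f (Sign.+ ∷ y)) + ∑ (allPoints n) (λ y → f (Sign.- ∷ y))
  ∑-cube-suc n f = trans (∑-allVecs-suc (Sign.+ ∷ Sign.- ∷ []) n f)
                         (∑-pair Sign.+ Sign.- (λ a → ∑ (allPoints n) (λ y → f (a ∷ y))))

  ∑-subsets-suc : ∀ n (f : Subset (suc n) → ℚ) →
    ∑ (allSubsets (suc n)) f
      ≡ ∑ (allSubsets n) (λ S → f (true ∷ S)) + ∑ (allSubsets n) (λ S → f (false ∷ S))
  ∑-subsets-suc n f = trans (∑-allVecs-suc (true ∷ false ∷ []) n f)
                            (∑-pair true false (λ a → ∑ (allSubsets n) (λ S → f (a ∷ S))))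

  fromℤ-+ : ∀ a b → fromℤ (a ℤ.+ b) ≡ fromℤ a + fromℤ b
  fromℤ-+ a b = sym (trans (cong (_/ 1) (cong₂ ℤ._+_ (ℤP.*-identityʳ a) (ℤP.*-identityʳ b)))
                           (ℚP.↥p/↧p≡p (fromℤ (a ℤ.+ b))))

  fromℤ-* : ∀ a b → fromℤ (a ℤ.* b) ≡ fromℤ a * fromℤ b
  fromℤ-* a b = sym (ℚP.↥p/↧p≡p (fromℤ (a ℤ.* b)))

  fromℤ-mono-≤ : ∀ {a b} → a ℤ.≤ b → fromℤ a ≤ fromℤ b
  fromℤ-mono-≤ {a} {b} a≤b = ℚ.*≤* (subst₂ ℤ._≤_ (sym (ℤP.*-identityʳ a)) (sym (ℤP.*-identityʳ b)) a≤b)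

  fromℕ : ℕ → ℚ
  fromℕ n = fromℤ (+ n)

  fromℕ-suc : ∀ n → fromℕ (suc n) ≡ 1ℚ + fromℕ n
  fromℕ-suc n = fromℤ-+ (+ 1) (+ n)

  fromℕ-* : ∀ m n → fromℕ (m ℕ.* n) ≡ fromℕ m * fromℕ n
  fromℕ-* m n = trans (cong fromℤ (ℤP.pos-* m n)) (fromℤ-* (+ m) (+ n))

  fromℕ-mono-≤ : ∀ {m n} → m ℕ.≤ n → fromℕ m ≤ fromℕ n
  fromℕ-mono-≤ m≤n = fromℤ-mono-≤ (ℤ.+≤+ m≤n)

  coordinateSum : {n : ℕ} → Point n → ℚ
  coordinateSum z = fromℤ (sumSigns z)

  coordinateSum-∷ : ∀ {n} x (z : Point n) → coordinateSum (x ∷ z) ≡ signℚ x + coordinateSum z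
  coordinateSum-∷ Sign.+ z = fromℤ-+ (+ 1) (sumSigns z)
  coordinateSum-∷ Sign.- z = fromℤ-+ (ℤ.- (+ 1)) (sumSigns z)

  b₁ b₂ b₃ b₄ : ℚ
  b₁ = + 19 / 250
  b₂ = - (+ 431 / 2000)
  b₃ = + 33 / 800
  b₄ = + 9 / 320

  -- Stated over an arbitrary raw ring with rational constants κ, so that the same text serves
  -- both as functions on ℚ and as expressions for the ring solver.
  module Formulas (R : RawRing 0ℓ 0ℓ) (κ : ℚ → RawRing.Carrier R) where
    open RawRing R using (Carrier; 0#; 1#) renaming (_+_ to _⊕_; _*_ to _⊗_; -_ to ⊝_)

    infixl 6 _⊖_
    _⊖_ : Carrier → Carrier → Carrier
    x ⊖ y = x ⊕ ⊝ y

    -- e₂, e₃, e₄ are the elementary symmetric polynomials of n signs, written in terms of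
    -- their sum s (e₀ = 1 and e₁ = s).
    e₂ e₃ e₄ : (s n : Carrier) → Carrier
    e₂ s n = κ ½ ⊗ (s ⊗ s ⊖ n)
    e₃ s n = κ (+ 1 / 6) ⊗ (s ⊗ s ⊗ s ⊖ (κ (+ 3 / 1) ⊗ n ⊖ κ (+ 2 / 1)) ⊗ s)
    e₄ s n = κ (+ 1 / 24) ⊗ (s ⊗ s ⊗ s ⊗ s ⊖ (κ (+ 6 / 1) ⊗ n ⊖ κ (+ 8 / 1)) ⊗ s ⊗ s
                            ⊕ κ (+ 3 / 1) ⊗ n ⊗ n ⊖ κ (+ 6 / 1) ⊗ n)

    elementarySum : (c₀ c₁ c₂ c₃ c₄ s n : Carrier) → Carrier
    elementarySum c₀ c₁ c₂ c₃ c₄ s n = c₀ ⊕ c₁ ⊗ s ⊕ c₂ ⊗ e₂ s n ⊕ c₃ ⊗ e₃ s n ⊕ c₄ ⊗ e₄ s n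

    -- Both are the quartic p(x) = b₁x + b₂x² + b₃x³ + b₄x⁴ minus its mean: gaussianQuartic for
    -- x standard Gaussian (E x² = 1, E x⁴ = 3), cubeQuartic r s K for x = r s with s the sum
    -- of K uniform signs (E s² = K, E s⁴ = 3K² − 2K).
    gaussianQuartic : Carrier → Carrier
    gaussianQuartic x =
      κ b₁ ⊗ x ⊕ κ b₂ ⊗ (x ⊗ x ⊖ 1#) ⊕ κ b₃ ⊗ (x ⊗ x ⊗ x) ⊕ κ b₄ ⊗ (x ⊗ x ⊗ x ⊗ x ⊖ κ (+ 3 / 1))

    cubeQuartic : (r s K : Carrier) → Carrier
    cubeQuartic r s K =
      κ b₁ ⊗ x ⊕ κ b₂ ⊗ (x ⊗ x ⊖ ρ) ⊕ κ b₃ ⊗ (x ⊗ x ⊗ x)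
        ⊕ κ b₄ ⊗ (x ⊗ x ⊗ x ⊗ x ⊖ (κ (+ 3 / 1) ⊗ ρ ⊗ ρ ⊖ κ (+ 2 / 1) ⊗ (r ⊗ r) ⊗ ρ))
      where
      x ρ : Carrier
      x = r ⊗ s
      ρ = r ⊗ r ⊗ K

    -- The coefficients of cubeQuartic r s K on e₁, …, e₄, read off from s² = 2e₂ + K,
    -- s³ = 6e₃ + (3K − 2)s and s⁴ = 24e₄ + (12K − 16)e₂ + 3K² − 2K.
    quarticCoefficient : (r K : Carrier) → ℕ → Carrier
    quarticCoefficient r K 1 = κ b₁ ⊗ r ⊕ (κ (+ 3 / 1) ⊗ K ⊖ κ (+ 2 / 1)) ⊗ (κ b₃ ⊗ (r ⊗ r ⊗ r))
    quarticCoefficient r K 2 =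
      κ (+ 2 / 1) ⊗ (κ b₂ ⊗ (r ⊗ r)) ⊕ (κ (+ 12 / 1) ⊗ K ⊖ κ (+ 16 / 1)) ⊗ (κ b₄ ⊗ (r ⊗ r ⊗ r ⊗ r))
    quarticCoefficient r K 3 = κ (+ 6 / 1) ⊗ (κ b₃ ⊗ (r ⊗ r ⊗ r))
    quarticCoefficient r K 4 = κ (+ 24 / 1) ⊗ (κ b₄ ⊗ (r ⊗ r ⊗ r ⊗ r))
    quarticCoefficient r K _ = 0#

    -- Certificates for the lower bounds on gaussianQuartic and cubeQuartic: the function minus
    -- its bound equals the slack, a sum of manifestly nonnegative terms.
    cubeQuartic-slack : (r K : Carrier) → Carrier
    cubeQuartic-slack r K =
      ⊝ κ b₂ ⊗ (ρ ⊖ 1#) ⊕ κ (+ 2 / 1) ⊗ κ b₄ ⊗ (r ⊗ r) ⊗ ρ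
        ⊕ κ (+ 3 / 1) ⊗ κ b₄ ⊗ (κ (+ 101 / 100) ⊖ ρ) ⊗ (κ (+ 101 / 100) ⊕ ρ) ⊕ κ (+ 973 / 3200000)
      where
      ρ : Carrier
      ρ = r ⊗ r ⊗ K

    gaussianQuartic-slack : Carrier → Carrier
    gaussianQuartic-slack x = κ b₄ ⊗ (q ⊗ q) ⊕ κ (+ 27 / 500) ⊗ (l ⊗ l) ⊕ κ (+ 8884487 / 345600000)
      where
      q l : Carrier
      q = x ⊗ x ⊕ κ (+ 11 / 15) ⊗ x ⊖ κ (+ 253 / 50)
      l = x ⊕ κ (+ 11389 / 4320)

    gaussianQuartic-slack-right : Carrier → Carrier
    gaussianQuartic-slack-right x =
      κ b₄ ⊗ (q ⊗ q) ⊕ κ (+ 1507 / 3600000) ⊗ (l ⊗ l) ⊕ κ (+ 118999259 / 4822400000)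
        ⊕ (x ⊕ κ (+ 503 / 1000)) ⊗ (κ (+ 17 / 200) ⊗ (t ⊗ t))
      where
      q l t : Carrier
      q = x ⊗ x ⊖ κ (+ 7 / 9) ⊗ x ⊖ κ (+ 67 / 100)
      l = x ⊖ κ (+ 3573 / 15070)
      t = x ⊖ κ (+ 7 / 5)

  open Formulas ℚ.+-*-rawRing id

  polynomialRing : ℕ → RawRing 0ℓ 0ℓ
  polynomialRing m = record
    { Carrier = Polynomial m ; _≈_ = _≡_ ; _+_ = _:+_ ; _*_ = _:*_ ; -_ = :-_ ; 0# = con 0ℚ ; 1# = con 1ℚ }

  module Expr {m : ℕ} = Formulas (polynomialRing m) con

  elementarySum-step : ∀ a c₀ c₁ c₂ c₃ c₄ s n →
    elementarySum c₀ c₁ c₂ c₃ c₄ (signℚ a + s) (1ℚ + n)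
      ≡ signℚ a * elementarySum c₁ c₂ c₃ c₄ 0ℚ s n + elementarySum c₀ c₁ c₂ c₃ c₄ s n
  elementarySum-step Sign.+ = solve 7 (λ c₀ c₁ c₂ c₃ c₄ s n →
    Expr.elementarySum c₀ c₁ c₂ c₃ c₄ (con 1ℚ :+ s) (con 1ℚ :+ n)
      := con 1ℚ :* Expr.elementarySum c₁ c₂ c₃ c₄ (con 0ℚ) s n :+ Expr.elementarySum c₀ c₁ c₂ c₃ c₄ s n) refl
  elementarySum-step Sign.- = solve 7 (λ c₀ c₁ c₂ c₃ c₄ s n →
    Expr.elementarySum c₀ c₁ c₂ c₃ c₄ (con (- 1ℚ) :+ s) (con 1ℚ :+ n)
      := con (- 1ℚ) :* Expr.elementarySum c₁ c₂ c₃ c₄ (con 0ℚ) s n :+ Expr.elementarySum c₀ c₁ c₂ c₃ c₄ s n) refl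

  elementarySum-empty : ∀ c₀ c₁ c₂ c₃ c₄ → elementarySum c₀ c₁ c₂ c₃ c₄ 0ℚ 0ℚ ≡ c₀ * 1ℚ + 0ℚ
  elementarySum-empty = solve 5 (λ c₀ c₁ c₂ c₃ c₄ →
    Expr.elementarySum c₀ c₁ c₂ c₃ c₄ (con 0ℚ) (con 0ℚ) := c₀ :* con 1ℚ :+ con 0ℚ) refl

  symmetricPoly : (k : ℕ) → (ℕ → ℚ) → MultilinPoly k
  symmetricPoly k c S = c ∣ S ∣

  eval-symmetricPoly-∷ : ∀ n (c : ℕ → ℚ) x (z : Point n) →
    eval (symmetricPoly (suc n) c) (x ∷ z)
      ≡ signℚ x * eval (symmetricPoly n (c ∘ suc)) z + eval (symmetricPoly n c) z
  eval-symmetricPoly-∷ n c x z = trans (∑-subsets-suc n _) (cong (_+ eval (symmetricPoly n c) z) (begin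
    ∑ (allSubsets n) (λ S → c (suc ∣ S ∣) * (signℚ x * monomial S z))
      ≡⟨ ∑-cong (allSubsets n) (λ S → swap (c (suc ∣ S ∣)) (monomial S z)) ⟩
    ∑ (allSubsets n) (λ S → signℚ x * (c (suc ∣ S ∣) * monomial S z))
      ≡⟨ ∑-*ˡ (allSubsets n) (signℚ x) _ ⟩
    signℚ x * eval (symmetricPoly n (c ∘ suc)) z ∎))
    where
    open ≡-Reasoning
    swap : ∀ a b → a * (signℚ x * b) ≡ signℚ x * (a * b)
    swap a b = solve 3 (λ a σ b → a :* (σ :* b) := σ :* (a :* b)) refl a (signℚ x) b

  eval-symmetricPoly : ∀ n (c : ℕ → ℚ) → (∀ j → c (5 ℕ.+ j) ≡ 0ℚ) → (z : Point n) →
    eval (symmetricPoly n c) z ≡ elementarySum (c 0) (c 1) (c 2) (c 3) (c 4) (coordinateSum z) (fromℕ n)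
  eval-symmetricPoly zero    c c≥5≡0 []      = sym (elementarySum-empty (c 0) (c 1) (c 2) (c 3) (c 4))
  eval-symmetricPoly (suc n) c c≥5≡0 (x ∷ z) = begin
    eval (symmetricPoly (suc n) c) (x ∷ z)
      ≡⟨ eval-symmetricPoly-∷ n c x z ⟩
    signℚ x * eval (symmetricPoly n (c ∘ suc)) z + eval (symmetricPoly n c) z
      ≡⟨ cong₂ (λ u v → signℚ x * u + v) shifted (eval-symmetricPoly n c c≥5≡0 z) ⟩
    signℚ x * elementarySum (c 1) (c 2) (c 3) (c 4) 0ℚ s (fromℕ n)
      + elementarySum (c 0) (c 1) (c 2) (c 3) (c 4) s (fromℕ n)
      ≡⟨ sym (elementarySum-step x (c 0) (c 1) (c 2) (c 3) (c 4) s (fromℕ n)) ⟩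
    elementarySum (c 0) (c 1) (c 2) (c 3) (c 4) (signℚ x + s) (1ℚ + fromℕ n)
      ≡⟨ sym (cong₂ (elementarySum (c 0) (c 1) (c 2) (c 3) (c 4)) (coordinateSum-∷ x z) (fromℕ-suc n)) ⟩
    elementarySum (c 0) (c 1) (c 2) (c 3) (c 4) (coordinateSum (x ∷ z)) (fromℕ (suc n)) ∎
    where
    open ≡-Reasoning
    s : ℚ
    s = coordinateSum z
    shifted : eval (symmetricPoly n (c ∘ suc)) z ≡ elementarySum (c 1) (c 2) (c 3) (c 4) 0ℚ s (fromℕ n)
    shifted = trans (eval-symmetricPoly n (c ∘ suc) (c≥5≡0 ∘ suc) z)
                    (cong (λ c₅ → elementarySum (c 1) (c 2) (c 3) (c 4) c₅ s (fromℕ n)) (c≥5≡0 0))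

  separatingPoly : (k : ℕ) → ℚ → MultilinPoly k
  separatingPoly k r = symmetricPoly k (quarticCoefficient r (fromℕ k))

  separatingPoly-degree : ∀ k r → DegreeAtMost 4 (separatingPoly k r)
  separatingPoly-degree k r S 4<∣S∣ with ∣ S ∣
  separatingPoly-degree k r S (s≤s (s≤s (s≤s (s≤s (s≤s _))))) | suc (suc (suc (suc (suc _)))) = refl

  ∣emptySet∣≡0 : ∀ k → ∣ emptySet k ∣ ≡ 0
  ∣emptySet∣≡0 zero    = refl
  ∣emptySet∣≡0 (suc k) = ∣emptySet∣≡0 k

  separatingPoly-∅ : ∀ k r → separatingPoly k r (emptySet k) ≡ 0ℚ
  separatingPoly-∅ k r = cong (quarticCoefficient r (fromℕ k)) (∣emptySet∣≡0 k)

  eval-separatingPoly : ∀ k r (z : Point k) →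
    eval (separatingPoly k r) z ≡ cubeQuartic r (coordinateSum z) (fromℕ k)
  eval-separatingPoly k r z =
    trans (eval-symmetricPoly k (quarticCoefficient r (fromℕ k)) (λ _ → refl) z)
          (in-elementary-basis r (coordinateSum z) (fromℕ k))
    where
    in-elementary-basis : ∀ r s K →
      elementarySum 0ℚ (quarticCoefficient r K 1) (quarticCoefficient r K 2) (quarticCoefficient r K 3)
                    (quarticCoefficient r K 4) s K
        ≡ cubeQuartic r s K
    in-elementary-basis = solve 3 (λ r s K →
      Expr.elementarySum (con 0ℚ) (Expr.quarticCoefficient r K 1) (Expr.quarticCoefficient r K 2)
                         (Expr.quarticCoefficient r K 3) (Expr.quarticCoefficient r K 4) s K
        := Expr.cubeQuartic r s K) refl

  0≤-by-≤ᵇ : ∀ p → {T (0ℚ ℚ.≤ᵇ p)} → 0ℚ ≤ p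
  0≤-by-≤ᵇ p {0≤ᵇp} = ℚP.≤ᵇ⇒≤ 0≤ᵇp

  0≤-+ : ∀ {p q} → 0ℚ ≤ p → 0ℚ ≤ q → 0ℚ ≤ p + q
  0≤-+ = ℚP.+-mono-≤

  0≤-* : ∀ {p q} → 0ℚ ≤ p → 0ℚ ≤ q → 0ℚ ≤ p * q
  0≤-* {p} {q} 0≤p 0≤q = ℚP.nonNegative⁻¹ (p * q)
    {{ℚP.nonNeg*nonNeg⇒nonNeg p {{ℚ.nonNegative 0≤p}} q {{ℚ.nonNegative 0≤q}}}}

  0≤-square : ∀ p → 0ℚ ≤ p * p
  0≤-square p with ℚP.≤-total 0ℚ p
  ... | inj₁ 0≤p = 0≤-* 0≤p 0≤p
  ... | inj₂ p≤0 = ℚP.nonNegative⁻¹ (p * p)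
    {{ℚP.nonPos*nonPos⇒nonPos p {{ℚ.nonPositive p≤0}} p {{ℚ.nonPositive p≤0}}}}

  p≤q⇒0≤q-p : ∀ {p q} → p ≤ q → 0ℚ ≤ q - p
  p≤q⇒0≤q-p {p} {q} p≤q = subst (_≤ q - p) (ℚP.+-inverseʳ p) (ℚP.+-monoˡ-≤ (- p) p≤q)

  ≤-by-slack : ∀ {p q} d → q ≡ p + d → 0ℚ ≤ d → p ≤ q
  ≤-by-slack {p} d q≡p+d 0≤d =
    subst (p ≤_) (sym q≡p+d) (subst (_≤ p + d) (ℚP.+-identityʳ p) (ℚP.+-monoʳ-≤ p 0≤d))

  gaussianQuartic-≤-cubeQuartic : ∀ r s K → 1ℚ ≤ r * r * K → r * r * K ≤ + 101 / 100 →
    gaussianQuartic (r * s) - + 1 / 500 ≤ cubeQuartic r s K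
  gaussianQuartic-≤-cubeQuartic r s K 1≤ρ ρ≤101/100 = ≤-by-slack (cubeQuartic-slack r K) identity
    (0≤-+ (0≤-+ (0≤-+ (0≤-* (0≤-by-≤ᵇ (- b₂)) (p≤q⇒0≤q-p 1≤ρ))
                      (0≤-* (0≤-* (0≤-by-≤ᵇ (+ 2 / 1 * b₄)) (0≤-square r)) 0≤ρ))
                (0≤-* (0≤-* (0≤-by-≤ᵇ (+ 3 / 1 * b₄)) (p≤q⇒0≤q-p ρ≤101/100))
                      (0≤-+ (0≤-by-≤ᵇ (+ 101 / 100)) 0≤ρ)))
           (0≤-by-≤ᵇ (+ 973 / 3200000)))
    where
    0≤ρ : 0ℚ ≤ r * r * K
    0≤ρ = ℚP.≤-trans (0≤-by-≤ᵇ 1ℚ) 1≤ρ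
    identity : cubeQuartic r s K ≡ gaussianQuartic (r * s) - + 1 / 500 + cubeQuartic-slack r K
    identity = solve 3 (λ r s K →
      Expr.cubeQuartic r s K := Expr.gaussianQuartic (r :* s) :- con (+ 1 / 500) :+ Expr.cubeQuartic-slack r K) refl r s K

  gaussianQuartic-lowerBound : ∀ x → - (+ 99 / 100) ≤ gaussianQuartic x
  gaussianQuartic-lowerBound x = ≤-by-slack (gaussianQuartic-slack x) identity
    (0≤-+ (0≤-+ (0≤-* (0≤-by-≤ᵇ b₄) (0≤-square (x * x + + 11 / 15 * x - + 253 / 50)))
                (0≤-* (0≤-by-≤ᵇ (+ 27 / 500)) (0≤-square (x + + 11389 / 4320))))
          (0≤-by-≤ᵇ (+ 8884487 / 345600000)))
    where
    identity : gaussianQuartic x ≡ - (+ 99 / 100) + gaussianQuartic-slack x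
    identity = solve 1 (λ x → Expr.gaussianQuartic x := con (- (+ 99 / 100)) :+ Expr.gaussianQuartic-slack x) refl x

  gaussianQuartic-lowerBound-right : ∀ x → 0ℚ ≤ x + + 503 / 1000 → + 1 / 100 ≤ gaussianQuartic x
  gaussianQuartic-lowerBound-right x 0≤x+503/1000 = ≤-by-slack (gaussianQuartic-slack-right x) identity
    (0≤-+ (0≤-+ (0≤-+ (0≤-* (0≤-by-≤ᵇ b₄) (0≤-square (x * x - + 7 / 9 * x - + 67 / 100)))
                      (0≤-* (0≤-by-≤ᵇ (+ 1507 / 3600000)) (0≤-square (x - + 3573 / 15070))))
                (0≤-by-≤ᵇ (+ 118999259 / 4822400000)))
          (0≤-* 0≤x+503/1000 (0≤-* (0≤-by-≤ᵇ (+ 17 / 200)) (0≤-square (x - + 7 / 5)))))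
    where
    identity : gaussianQuartic x ≡ + 1 / 100 + gaussianQuartic-slack-right x
    identity = solve 1 (λ x → Expr.gaussianQuartic x := con (+ 1 / 100) :+ Expr.gaussianQuartic-slack-right x) refl x

  -- 503/1000 exceeds √(101/100) / 2.
  square-bound⇒right : ∀ x → (+ 2 / 1 * x) * (+ 2 / 1 * x) ≤ + 101 / 100 → 0ℚ ≤ x + + 503 / 1000
  square-bound⇒right x 4x²≤101/100 = [ id , ⊥-elim ∘ not-left ]′ (ℚP.≤-total 0ℚ (x + + 503 / 1000))
    where
    not-left : x + + 503 / 1000 ≤ 0ℚ → ⊥
    not-left x+c≤0 = ℚP.≤⇒≤ᵇ (ℚP.≤-trans {+ 253009 / 250000} 4x²-large 4x²≤101/100)
      where
      u : ℚ
      u = - (x + + 503 / 1000)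
      0≤u : 0ℚ ≤ u
      0≤u = ℚP.neg-antimono-≤ x+c≤0
      4x²-large : + 253009 / 250000 ≤ (+ 2 / 1 * x) * (+ 2 / 1 * x)
      4x²-large = ≤-by-slack (+ 4 / 1 * u * (u + + 503 / 500))
        (solve 1 (λ x → (con (+ 2 / 1) :* x) :* (con (+ 2 / 1) :* x)
                          := con (+ 253009 / 250000) :+ con (+ 4 / 1) :* (:- (x :+ con (+ 503 / 1000)))
                               :* (:- (x :+ con (+ 503 / 1000)) :+ con (+ 503 / 500))) refl x)
        (0≤-* (0≤-* (0≤-by-≤ᵇ (+ 4 / 1)) 0≤u) (0≤-+ 0≤u (0≤-by-≤ᵇ (+ 503 / 500))))

  right-of-threshold : ∀ r s K → 0ℚ ≤ r → r * r * K ≤ + 101 / 100 →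
    0ℚ ≤ s ⊎ (+ 2 / 1 * s) * (+ 2 / 1 * s) ≤ K → 0ℚ ≤ r * s + + 503 / 1000
  right-of-threshold r s K 0≤r _        (inj₁ 0≤s)   = 0≤-+ (0≤-* 0≤r 0≤s) (0≤-by-≤ᵇ (+ 503 / 1000))
  right-of-threshold r s K _   ρ≤101/100 (inj₂ 4s²≤K) = square-bound⇒right (r * s) (begin
    (+ 2 / 1 * (r * s)) * (+ 2 / 1 * (r * s))  ≡⟨ solve 2 (λ r s → (con (+ 2 / 1) :* (r :* s)) :* (con (+ 2 / 1) :* (r :* s))
                                                   := (r :* r) :* ((con (+ 2 / 1) :* s) :* (con (+ 2 / 1) :* s))) refl r s ⟩
    (r * r) * ((+ 2 / 1 * s) * (+ 2 / 1 * s))  ≤⟨ ℚP.*-monoˡ-≤-nonNeg (r * r) {{ℚ.nonNegative (0≤-square r)}} 4s²≤K ⟩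
    r * r * K                                  ≤⟨ ρ≤101/100 ⟩
    + 101 / 100                                ∎)
    where open ℚP.≤-Reasoning

  ThrNegHalfSqrt⇒ : ∀ k (z : Point k) → ThrNegHalfSqrt k z ≡ true →
    0ℚ ≤ coordinateSum z ⊎ (+ 2 / 1 * coordinateSum z) * (+ 2 / 1 * coordinateSum z) ≤ fromℕ k
  ThrNegHalfSqrt⇒ k z thr with + 0 ℤ.≤ᵇ sumSigns z in 0≤ᵇs
  ... | true  = inj₁ (fromℤ-mono-≤ (ℤP.≤ᵇ⇒≤ (subst T (sym 0≤ᵇs) tt)))
  ... | false = inj₂ (subst (_≤ fromℕ k) embed (fromℤ-mono-≤ (ℤP.≤ᵇ⇒≤ (subst T (sym thr) tt))))
    where
    s : ℤ
    s = sumSigns z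
    embed : fromℤ (+ 2 ℤ.* s ℤ.* (+ 2 ℤ.* s)) ≡ (+ 2 / 1 * coordinateSum z) * (+ 2 / 1 * coordinateSum z)
    embed = trans (fromℤ-* (+ 2 ℤ.* s) (+ 2 ℤ.* s)) (cong₂ _*_ (fromℤ-* (+ 2) s) (fromℤ-* (+ 2) s))

  separatingPoly-separates : ∀ k r → 0ℚ ≤ r → 1ℚ ≤ r * r * fromℕ k → r * r * fromℕ k ≤ + 101 / 100 →
    Separates (+ 1 / 225) (ThrNegHalfSqrt k) (separatingPoly k r)
  separatingPoly-separates k r 0≤r 1≤ρ ρ≤101/100 = lower , upper , separatingPoly-∅ k r
    where
    open ℚP.≤-Reasoning
    K : ℚ
    K = fromℕ k
    lower : ∀ z → + 1 / 225 - 1ℚ ≤ eval (separatingPoly k r) z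
    lower z = begin
      + 1 / 225 - 1ℚ                       ≤⟨ ℚP.≤ᵇ⇒≤ tt ⟩
      - (+ 99 / 100) - + 1 / 500           ≤⟨ ℚP.+-monoˡ-≤ (- (+ 1 / 500)) (gaussianQuartic-lowerBound (r * s)) ⟩
      gaussianQuartic (r * s) - + 1 / 500  ≤⟨ gaussianQuartic-≤-cubeQuartic r s K 1≤ρ ρ≤101/100 ⟩
      cubeQuartic r s K                    ≡⟨ sym (eval-separatingPoly k r z) ⟩
      eval (separatingPoly k r) z          ∎
      where
      s : ℚ
      s = coordinateSum z
    upper : ∀ z → ThrNegHalfSqrt k z ≡ true → + 1 / 225 ≤ eval (separatingPoly k r) z
    upper z thr = begin
      + 1 / 225                            ≤⟨ ℚP.≤ᵇ⇒≤ tt ⟩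
      + 1 / 100 - + 1 / 500                ≤⟨ ℚP.+-monoˡ-≤ (- (+ 1 / 500)) (gaussianQuartic-lowerBound-right (r * s) right) ⟩
      gaussianQuartic (r * s) - + 1 / 500  ≤⟨ gaussianQuartic-≤-cubeQuartic r s K 1≤ρ ρ≤101/100 ⟩
      cubeQuartic r s K                    ≡⟨ sym (eval-separatingPoly k r z) ⟩
      eval (separatingPoly k r) z          ∎
      where
      s : ℚ
      s = coordinateSum z
      right : 0ℚ ≤ r * s + + 503 / 1000
      right = right-of-threshold r s K 0≤r ρ≤101/100 (ThrNegHalfSqrt⇒ k z thr)

  floor-sqrt : ∀ N → Σ ℕ λ m → m ℕ.* m ℕ.≤ N × N ℕ.< suc m ℕ.* suc m
  floor-sqrt zero    = 0 , z≤n , s≤s z≤n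
  floor-sqrt (suc N) with floor-sqrt N
  ... | m , m²≤N , N<[1+m]² with suc m ℕ.* suc m ℕ.≤? suc N
  ...   | yes [1+m]²≤1+N = suc m , [1+m]²≤1+N , ℕP.<-≤-trans (s≤s N<[1+m]²) [1+m]²<[2+m]²
    where
    [1+m]²<[2+m]² : suc m ℕ.* suc m ℕ.< suc (suc m) ℕ.* suc (suc m)
    [1+m]²<[2+m]² = ℕP.*-mono-< (ℕP.n<1+n (suc m)) (ℕP.n<1+n (suc m))
  ...   | no  [1+m]²≰1+N = m , ℕP.m≤n⇒m≤1+n m²≤N , ℕP.≰⇒> [1+m]²≰1+N

  floor-sqrt-large : ∀ {N m} → 40401 ℕ.≤ N → N ℕ.< suc m ℕ.* suc m → 201 ℕ.≤ m
  floor-sqrt-large {N} 40401≤N N<[1+m]² = ℕP.≮⇒≥ λ m<201 →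
    ℕP.<-irrefl refl (ℕP.<-≤-trans N<[1+m]² (ℕP.≤-trans (ℕP.*-mono-≤ m<201 m<201) 40401≤N))

  floor-sqrt-tight : ∀ {N m} → 201 ℕ.≤ m → N ℕ.< suc m ℕ.* suc m → 100 ℕ.* N ℕ.≤ 101 ℕ.* (m ℕ.* m)
  floor-sqrt-tight {N} {m} 201≤m N<[1+m]² = begin
    100 ℕ.* N                                 ≤⟨ ℕP.*-monoʳ-≤ 100 (ℕP.<⇒≤ N<[1+m]²) ⟩
    100 ℕ.* (suc m ℕ.* suc m)                 ≡⟨ expand m ⟩
    100 ℕ.* (m ℕ.* m) ℕ.+ (200 ℕ.* m ℕ.+ 100) ≤⟨ ℕP.+-monoʳ-≤ (100 ℕ.* (m ℕ.* m)) linear≤m² ⟩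
    100 ℕ.* (m ℕ.* m) ℕ.+ m ℕ.* m             ≡⟨ collect m ⟩
    101 ℕ.* (m ℕ.* m)                         ∎
    where
    open ℕP.≤-Reasoning
    expand : ∀ m → 100 ℕ.* (suc m ℕ.* suc m) ≡ 100 ℕ.* (m ℕ.* m) ℕ.+ (200 ℕ.* m ℕ.+ 100)
    expand = ℕ-Ring.solve-∀
    collect : ∀ m → 100 ℕ.* (m ℕ.* m) ℕ.+ m ℕ.* m ≡ 101 ℕ.* (m ℕ.* m)
    collect = ℕ-Ring.solve-∀
    linear≤m² : 200 ℕ.* m ℕ.+ 100 ℕ.≤ m ℕ.* m
    linear≤m² = begin
      200 ℕ.* m ℕ.+ 100    ≤⟨ ℕP.+-monoʳ-≤ (200 ℕ.* m) (ℕP.≤-trans (ℕP.m≤m+n 100 101) 201≤m) ⟩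
      200 ℕ.* m ℕ.+ m      ≡⟨ ℕP.+-comm (200 ℕ.* m) m ⟩
      201 ℕ.* m            ≤⟨ ℕP.*-monoˡ-≤ m 201≤m ⟩
      m ℕ.* m              ∎

  inverse-square-bounds : ∀ {u M N} → u * M ≡ 1ℚ → M * M ≤ N → + 100 / 1 * N ≤ + 101 / 1 * (M * M) →
    1ℚ ≤ u * u * N × u * u * N ≤ + 101 / 100
  inverse-square-bounds {u} {M} {N} uM≡1 M²≤N 100N≤101M² = lower , upper
    where
    open ℚP.≤-Reasoning
    u²M²≡1 : u * u * (M * M) ≡ 1ℚ
    u²M²≡1 = trans (solve 2 (λ u M → u :* u :* (M :* M) := (u :* M) :* (u :* M)) refl u M)
                   (cong₂ _*_ uM≡1 uM≡1)
    lower : 1ℚ ≤ u * u * N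
    lower = begin
      1ℚ                 ≡⟨ sym u²M²≡1 ⟩
      u * u * (M * M)    ≤⟨ ℚP.*-monoˡ-≤-nonNeg (u * u) {{ℚ.nonNegative (0≤-square u)}} M²≤N ⟩
      u * u * N          ∎
    upper : u * u * N ≤ + 101 / 100
    upper = begin
      u * u * N                                  ≡⟨ solve 2 (λ u N → u :* u :* N
                                                      := con (+ 1 / 100) :* (u :* u) :* (con (+ 100 / 1) :* N)) refl u N ⟩
      + 1 / 100 * (u * u) * (+ 100 / 1 * N)      ≤⟨ ℚP.*-monoˡ-≤-nonNeg (+ 1 / 100 * (u * u))
                                                      {{ℚ.nonNegative (0≤-* (0≤-by-≤ᵇ (+ 1 / 100)) (0≤-square u))}} 100N≤101M² ⟩
      + 1 / 100 * (u * u) * (+ 101 / 1 * (M * M)) ≡⟨ solve 2 (λ u M → con (+ 1 / 100) :* (u :* u) :* (con (+ 101 / 1) :* (M :* M))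
                                                      := con (+ 101 / 100) :* (u :* u :* (M :* M))) refl u M ⟩
      + 101 / 100 * (u * u * (M * M))            ≡⟨ cong (+ 101 / 100 *_) u²M²≡1 ⟩
      + 101 / 100 * 1ℚ                           ≡⟨ ℚP.*-identityʳ (+ 101 / 100) ⟩
      + 101 / 100                                ∎

  -- r = 40 / m ≈ 1/√k; the factor 1600 makes the integer square root precise enough.
  scale-from-approximate-root : ∀ k m → 201 ℕ.≤ m →
    m ℕ.* m ℕ.≤ 1600 ℕ.* k → 100 ℕ.* (1600 ℕ.* k) ℕ.≤ 101 ℕ.* (m ℕ.* m) →
    Σ ℚ λ r → 0ℚ ≤ r × 1ℚ ≤ r * r * fromℕ k × r * r * fromℕ k ≤ + 101 / 100
  scale-from-approximate-root k m@(suc _) _ m²≤N 100N≤101m² =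
    + 40 / 1 * u , 0≤r , subst (λ ρ → 1ℚ ≤ ρ × ρ ≤ + 101 / 100) (sym rescale) bounds
    where
    M u : ℚ
    M = fromℕ m
    u = 1/ M
    0≤r : 0ℚ ≤ + 40 / 1 * u
    0≤r = 0≤-* (0≤-by-≤ᵇ (+ 40 / 1)) (ℚP.<⇒≤ (ℚP.positive⁻¹ u {{ℚP.1/pos⇒pos M}}))
    rescale : + 40 / 1 * u * (+ 40 / 1 * u) * fromℕ k ≡ u * u * fromℕ (1600 ℕ.* k)
    rescale = trans (solve 2 (λ u K → con (+ 40 / 1) :* u :* (con (+ 40 / 1) :* u) :* K
                                     := u :* u :* (con (+ 1600 / 1) :* K)) refl u (fromℕ k))
                    (cong (u * u *_) (sym (fromℕ-* 1600 k)))
    bounds : 1ℚ ≤ u * u * fromℕ (1600 ℕ.* k) × u * u * fromℕ (1600 ℕ.* k) ≤ + 101 / 100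
    bounds = inverse-square-bounds {u} {M} {fromℕ (1600 ℕ.* k)} (ℚP.*-inverseˡ M)
      (subst (_≤ fromℕ (1600 ℕ.* k)) (fromℕ-* m m) (fromℕ-mono-≤ m²≤N))
      (subst₂ _≤_ (fromℕ-* 100 (1600 ℕ.* k)) (trans (fromℕ-* 101 (m ℕ.* m)) (cong (+ 101 / 1 *_) (fromℕ-* m m)))
              (fromℕ-mono-≤ 100N≤101m²))

  normalising-scale : ∀ k → 26 ℕ.≤ k →
    Σ ℚ λ r → 0ℚ ≤ r × 1ℚ ≤ r * r * fromℕ k × r * r * fromℕ k ≤ + 101 / 100
  normalising-scale k 26≤k with floor-sqrt (1600 ℕ.* k)
  ... | m , m²≤N , N<[1+m]² = scale-from-approximate-root k m 201≤m m²≤N (floor-sqrt-tight 201≤m N<[1+m]²)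
    where
    201≤m : 201 ℕ.≤ m
    201≤m = floor-sqrt-large (ℕP.≤-trans (ℕP.m≤m+n 40401 1199) (ℕP.*-monoʳ-≤ 1600 26≤k)) N<[1+m]²

  _⊆_ : {n : ℕ} → Subset n → Subset n → Set
  _⊆_ = Pointwise Bool._≤_

  ⊆-extend : ∀ {n} (S : Subset n) j → ∣ S ∣ ℕ.≤ j → j ℕ.≤ n → Σ (Subset n) λ T → S ⊆ T × ∣ T ∣ ≡ j
  ⊆-extend []          zero    _            _         = [] , [] , refl
  ⊆-extend (true ∷ S)  (suc j) (s≤s ∣S∣≤j) (s≤s j≤n) with ⊆-extend S j ∣S∣≤j j≤n
  ... | T , S⊆T , ∣T∣≡j = true ∷ T , Bool.b≤b ∷ S⊆T , cong suc ∣T∣≡j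
  ⊆-extend {suc n} (false ∷ S) j ∣S∣≤j j≤1+n with j ℕ.≤? n
  ... | yes j≤n with ⊆-extend S j ∣S∣≤j j≤n
  ...   | T , S⊆T , ∣T∣≡j = false ∷ T , Bool.b≤b ∷ S⊆T , ∣T∣≡j
  ⊆-extend {suc n} (false ∷ S) j ∣S∣≤j j≤1+n | no j≰n with ⊆-extend S n (∣p∣≤n S) ℕP.≤-refl
  ...   | T , S⊆T , ∣T∣≡n =
    true ∷ T , Bool.f≤t ∷ S⊆T , trans (cong suc ∣T∣≡n) (ℕP.≤-antisym (ℕP.≰⇒> j≰n) j≤1+n)

  -- 2^(n − |T|), the number of points with prescribed coordinates on T.
  fibreSize : {n : ℕ} → Subset n → ℚ
  fibreSize []          = 1ℚ
  fibreSize (true ∷ T)  = fibreSize T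
  fibreSize (false ∷ T) = fibreSize T + fibreSize T

  fibreSize-positive : ∀ {n} (T : Subset n) → ℚ.Positive (fibreSize T)
  fibreSize-positive []          = _
  fibreSize-positive (true ∷ T)  = fibreSize-positive T
  fibreSize-positive (false ∷ T) =
    ℚP.pos+pos⇒pos (fibreSize T) {{fibreSize-positive T}} (fibreSize T) {{fibreSize-positive T}}

  *-cancelˡ-≡0 : ∀ p .{{_ : ℚ.Positive p}} {q} → p * q ≡ 0ℚ → q ≡ 0ℚ
  *-cancelˡ-≡0 p {q} pq≡0 = begin
    q               ≡⟨ sym (ℚP.*-identityˡ q) ⟩
    1ℚ * q          ≡⟨ cong (_* q) (sym (ℚP.*-inverseˡ p)) ⟩
    1/ p * p * q    ≡⟨ ℚP.*-assoc (1/ p) p q ⟩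
    1/ p * (p * q)  ≡⟨ cong (1/ p *_) pq≡0 ⟩
    1/ p * 0ℚ       ≡⟨ ℚP.*-zeroʳ (1/ p) ⟩
    0ℚ              ∎
    where
    open ≡-Reasoning
    instance
      p≢0 : ℚ.NonZero p
      p≢0 = ℚP.pos⇒nonZero p

  ∑-agreeing-∷ : ∀ n x (z : Point n) (T : Subset n) (f : Point (suc n) → ℚ) →
    ∑ (allPoints (suc n)) (λ y → f y * indicator (agreeOn (true ∷ T) y (x ∷ z)))
      ≡ ∑ (allPoints n) (λ y → f (x ∷ y) * indicator (agreeOn T y z))
  ∑-agreeing-∷ n Sign.+ z T f = trans (∑-cube-suc n _)
    (trans (cong (_+_ (agreeing Sign.+)) (∑-zero (allPoints n) (λ y → ℚP.*-zeroʳ (f (Sign.- ∷ y)))))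
           (ℚP.+-identityʳ (agreeing Sign.+)))
    where
    agreeing : Sign → ℚ
    agreeing x = ∑ (allPoints n) (λ y → f (x ∷ y) * indicator (agreeOn T y z))
  ∑-agreeing-∷ n Sign.- z T f = trans (∑-cube-suc n _)
    (trans (cong (_+ agreeing Sign.-) (∑-zero (allPoints n) (λ y → ℚP.*-zeroʳ (f (Sign.+ ∷ y)))))
           (ℚP.+-identityˡ (agreeing Sign.-)))
    where
    agreeing : Sign → ℚ
    agreeing x = ∑ (allPoints n) (λ y → f (x ∷ y) * indicator (agreeOn T y z))

  ∑-monomial-agreeing : ∀ {n} {S T : Subset n} → S ⊆ T → (z : Point n) →
    ∑ (allPoints n) (λ y → monomial S y * indicator (agreeOn T y z)) ≡ fibreSize T * monomial S z
  ∑-monomial-agreeing [] [] = refl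
  ∑-monomial-agreeing {suc n} {true ∷ S} {true ∷ T} (_ ∷ S⊆T) (x ∷ z) = begin
    ∑ (allPoints (suc n)) (λ y → monomial (true ∷ S) y * indicator (agreeOn (true ∷ T) y (x ∷ z)))
      ≡⟨ ∑-agreeing-∷ n x z T (monomial (true ∷ S)) ⟩
    ∑ (allPoints n) (λ y → signℚ x * monomial S y * indicator (agreeOn T y z))
      ≡⟨ ∑-cong (allPoints n) (λ y → ℚP.*-assoc (signℚ x) (monomial S y) _) ⟩
    ∑ (allPoints n) (λ y → signℚ x * (monomial S y * indicator (agreeOn T y z)))
      ≡⟨ ∑-*ˡ (allPoints n) (signℚ x) _ ⟩
    signℚ x * ∑ (allPoints n) (λ y → monomial S y * indicator (agreeOn T y z))
      ≡⟨ cong (signℚ x *_) (∑-monomial-agreeing S⊆T z) ⟩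
    signℚ x * (fibreSize T * monomial S z)
      ≡⟨ solve 3 (λ σ F m → σ :* (F :* m) := F :* (σ :* m)) refl (signℚ x) (fibreSize T) (monomial S z) ⟩
    fibreSize T * (signℚ x * monomial S z) ∎
    where open ≡-Reasoning
  ∑-monomial-agreeing {suc n} {false ∷ S} {true ∷ T} (_ ∷ S⊆T) (x ∷ z) =
    trans (∑-agreeing-∷ n x z T (monomial (false ∷ S))) (∑-monomial-agreeing S⊆T z)
  ∑-monomial-agreeing {suc n} {false ∷ S} {false ∷ T} (_ ∷ S⊆T) (x ∷ z) =
    trans (∑-cube-suc n _) (trans (cong₂ _+_ (∑-monomial-agreeing S⊆T z) (∑-monomial-agreeing S⊆T z))
                                  (sym (ℚP.*-distribʳ-+ (monomial S z) (fibreSize T) (fibreSize T))))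

  ∑-monomial : ∀ {n} (S : Subset n) → 1 ℕ.≤ ∣ S ∣ → ∑ (allPoints n) (monomial S) ≡ 0ℚ
  ∑-monomial {suc n} (true ∷ S) _ = begin
    ∑ (allPoints (suc n)) (monomial (true ∷ S))
      ≡⟨ ∑-cube-suc n _ ⟩
    ∑ (allPoints n) (λ y → 1ℚ * monomial S y) + ∑ (allPoints n) (λ y → - 1ℚ * monomial S y)
      ≡⟨ cong₂ _+_ (∑-*ˡ (allPoints n) 1ℚ (monomial S)) (∑-*ˡ (allPoints n) (- 1ℚ) (monomial S)) ⟩
    1ℚ * ∑ (allPoints n) (monomial S) + - 1ℚ * ∑ (allPoints n) (monomial S)
      ≡⟨ solve 1 (λ a → con 1ℚ :* a :+ con (- 1ℚ) :* a := con 0ℚ) refl (∑ (allPoints n) (monomial S)) ⟩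
    0ℚ ∎
    where open ≡-Reasoning
  ∑-monomial {suc n} (false ∷ S) 1≤∣S∣ =
    trans (∑-cube-suc n _) (cong₂ _+_ (∑-monomial S 1≤∣S∣) (∑-monomial S 1≤∣S∣))

  ∑-mass : ∀ {n} (μ : Distribution n) (E : Point n → Point n → Bool) (g : Point n → ℚ) →
    ∑ (allPoints n) (λ y → g y * mass μ (E y))
      ≡ ∑ (allPoints n) (λ z → prob μ z * ∑ (allPoints n) (λ y → g y * indicator (E y z)))
  ∑-mass {n} μ E g = begin
    ∑ cube (λ y → g y * mass μ (E y))
      ≡⟨ ∑-cong cube (λ y → cong (g y *_) (∑-filter cube (E y) (prob μ))) ⟩
    ∑ cube (λ y → g y * ∑ cube (λ z → prob μ z * indicator (E y z)))
      ≡⟨ ∑-cong cube (λ y → sym (∑-*ˡ cube (g y) _)) ⟩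
    ∑ cube (λ y → ∑ cube (λ z → g y * (prob μ z * indicator (E y z))))
      ≡⟨ ∑-comm cube cube _ ⟩
    ∑ cube (λ z → ∑ cube (λ y → g y * (prob μ z * indicator (E y z))))
      ≡⟨ ∑-cong cube (λ z → ∑-cong cube (λ y → solve 3 (λ a b c → a :* (b :* c) := b :* (a :* c)) refl
                                                       (g y) (prob μ z) (indicator (E y z)))) ⟩
    ∑ cube (λ z → ∑ cube (λ y → prob μ z * (g y * indicator (E y z))))
      ≡⟨ ∑-cong cube (λ z → ∑-*ˡ cube (prob μ z) _) ⟩
    ∑ cube (λ z → prob μ z * ∑ cube (λ y → g y * indicator (E y z))) ∎
    where
    open ≡-Reasoning
    cube : List (Point n)
    cube = allPoints n

  -- Extending S to a set T of size 4, χ_S(z) only depends on z restricted to T, which is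
  -- uniformly distributed under μ.
  fourWise-∑-monomial : ∀ {k} (μ : Distribution k) → FourWiseUniform μ → 4 ℕ.≤ k →
    ∀ S → 1 ℕ.≤ ∣ S ∣ → ∣ S ∣ ℕ.≤ 4 → ∑ (allPoints k) (λ z → prob μ z * monomial S z) ≡ 0ℚ
  fourWise-∑-monomial {k} μ uniform 4≤k S 1≤∣S∣ ∣S∣≤4 with ⊆-extend S 4 ∣S∣≤4 4≤k
  ... | T , S⊆T , ∣T∣≡4 = *-cancelˡ-≡0 (fibreSize T) {{fibreSize-positive T}} (begin
    fibreSize T * ∑ cube (λ z → prob μ z * monomial S z)
      ≡⟨ sym (∑-*ˡ cube (fibreSize T) _) ⟩
    ∑ cube (λ z → fibreSize T * (prob μ z * monomial S z))
      ≡⟨ ∑-cong cube (λ z → solve 3 (λ F p m → F :* (p :* m) := p :* (F :* m)) refl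
                                    (fibreSize T) (prob μ z) (monomial S z)) ⟩
    ∑ cube (λ z → prob μ z * (fibreSize T * monomial S z))
      ≡⟨ ∑-cong cube (λ z → cong (prob μ z *_) (sym (∑-monomial-agreeing S⊆T z))) ⟩
    ∑ cube (λ z → prob μ z * ∑ cube (λ y → monomial S y * indicator (agreeOn T y z)))
      ≡⟨ sym (∑-mass μ (agreeOn T) (monomial S)) ⟩
    ∑ cube (λ y → monomial S y * mass μ (agreeOn T y))
      ≡⟨ ∑-cong cube (λ y → trans (cong (monomial S y *_) (uniform T ∣T∣≡4 y)) (ℚP.*-comm (monomial S y) _)) ⟩
    ∑ cube (λ y → + 1 / 16 * monomial S y)
      ≡⟨ ∑-*ˡ cube (+ 1 / 16) (monomial S) ⟩
    + 1 / 16 * ∑ cube (monomial S)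
      ≡⟨ cong (+ 1 / 16 *_) (∑-monomial S 1≤∣S∣) ⟩
    + 1 / 16 * 0ℚ
      ≡⟨ ℚP.*-zeroʳ (+ 1 / 16) ⟩
    0ℚ ∎)
    where
    open ≡-Reasoning
    cube : List (Point k)
    cube = allPoints k

  ∣S∣≡0⇒S≡emptySet : ∀ {n} (S : Subset n) → ∣ S ∣ ≡ 0 → S ≡ emptySet n
  ∣S∣≡0⇒S≡emptySet []          _     = refl
  ∣S∣≡0⇒S≡emptySet (false ∷ S) ∣S∣≡0 = cong (false ∷_) (∣S∣≡0⇒S≡emptySet S ∣S∣≡0)

  fourWise-∑-eval : ∀ {k} (μ : Distribution k) → FourWiseUniform μ → 4 ℕ.≤ k →
    ∀ Q → DegreeAtMost 4 Q → Q (emptySet k) ≡ 0ℚ → ∑ (allPoints k) (λ z → prob μ z * eval Q z) ≡ 0ℚ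
  fourWise-∑-eval {k} μ uniform 4≤k Q deg Q∅≡0 = begin
    ∑ cube (λ z → prob μ z * ∑ subsets (λ S → Q S * monomial S z))
      ≡⟨ ∑-cong cube (λ z → sym (∑-*ˡ subsets (prob μ z) _)) ⟩
    ∑ cube (λ z → ∑ subsets (λ S → prob μ z * (Q S * monomial S z)))
      ≡⟨ ∑-comm cube subsets _ ⟩
    ∑ subsets (λ S → ∑ cube (λ z → prob μ z * (Q S * monomial S z)))
      ≡⟨ ∑-cong subsets (λ S → trans (∑-cong cube (λ z → solve 3 (λ p q m → p :* (q :* m) := q :* (p :* m)) refl
                                                                   (prob μ z) (Q S) (monomial S z)))
                                     (∑-*ˡ cube (Q S) _)) ⟩
    ∑ subsets (λ S → Q S * ∑ cube (λ z → prob μ z * monomial S z))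
      ≡⟨ ∑-zero subsets term-vanishes ⟩
    0ℚ ∎
    where
    open ≡-Reasoning
    cube : List (Point k)
    cube = allPoints k
    subsets : List (Subset k)
    subsets = allSubsets k
    mean : Subset k → ℚ
    mean S = ∑ cube (λ z → prob μ z * monomial S z)
    term-vanishes : ∀ S → Q S * mean S ≡ 0ℚ
    term-vanishes S with ∣ S ∣ ℕ.≟ 0 | 4 ℕ.<? ∣ S ∣
    ... | yes ∣S∣≡0 | _ =
      trans (cong (_* mean S) (trans (cong Q (∣S∣≡0⇒S≡emptySet S ∣S∣≡0)) Q∅≡0)) (ℚP.*-zeroˡ (mean S))
    ... | no _ | yes 4<∣S∣ = trans (cong (_* mean S) (deg S 4<∣S∣)) (ℚP.*-zeroˡ (mean S))
    ... | no ∣S∣≢0 | no 4≮∣S∣ =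
      trans (cong (Q S *_) (fourWise-∑-monomial μ uniform 4≤k S (ℕP.n≢0⇒n>0 ∣S∣≢0) (ℕP.≮⇒≥ 4≮∣S∣)))
            (ℚP.*-zeroʳ (Q S))

  separating⇒far : ∀ {k δ} {P : Point k → Bool} {Q : MultilinPoly k} →
    4 ℕ.≤ k → DegreeAtMost 4 Q → Separates δ P Q → FarFromFourWise δ P
  separating⇒far {k} {δ} {P} {Q} 4≤k deg (Q≥δ-1 , P⇒Q≥δ , Q∅≡0) μ uniform = begin
    δ
      ≡⟨ sym (ℚP.*-identityʳ δ) ⟩
    δ * 1ℚ
      ≡⟨ cong (δ *_) (sym (total μ)) ⟩
    δ * ∑ cube (prob μ)
      ≡⟨ sym (∑-*ˡ cube δ (prob μ)) ⟩
    ∑ cube (λ z → δ * prob μ z)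
      ≡⟨ ∑-cong cube (λ z → ℚP.*-comm δ (prob μ z)) ⟩
    ∑ cube (λ z → prob μ z * δ)
      ≤⟨ ∑-mono-≤ cube weighted ⟩
    ∑ cube (λ z → prob μ z * (eval Q z + indicator (not (P z))))
      ≡⟨ ∑-cong cube (λ z → ℚP.*-distribˡ-+ (prob μ z) _ _) ⟩
    ∑ cube (λ z → prob μ z * eval Q z + prob μ z * indicator (not (P z)))
      ≡⟨ ∑-+ cube _ _ ⟩
    ∑ cube (λ z → prob μ z * eval Q z) + ∑ cube (λ z → prob μ z * indicator (not (P z)))
      ≡⟨ cong₂ _+_ (fourWise-∑-eval μ uniform 4≤k Q deg Q∅≡0) (sym (∑-filter cube (not ∘ P) (prob μ))) ⟩
    0ℚ + mass μ (not ∘ P)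
      ≡⟨ ℚP.+-identityˡ _ ⟩
    mass μ (not ∘ P) ∎
    where
    open ℚP.≤-Reasoning
    cube : List (Point k)
    cube = allPoints k
    pointwise : ∀ z → δ ≤ eval Q z + indicator (not (P z))
    pointwise z with P z in Pz
    ... | true  = subst (δ ≤_) (sym (ℚP.+-identityʳ (eval Q z))) (P⇒Q≥δ z Pz)
    ... | false = begin
      δ                ≡⟨ solve 1 (λ d → d := d :- con 1ℚ :+ con 1ℚ) refl δ ⟩
      δ - 1ℚ + 1ℚ      ≤⟨ ℚP.+-monoˡ-≤ 1ℚ (Q≥δ-1 z) ⟩
      eval Q z + 1ℚ    ∎
    weighted : ∀ z → prob μ z * δ ≤ prob μ z * (eval Q z + indicator (not (P z)))
    weighted z = ℚP.*-monoˡ-≤-nonNeg (prob μ z) {{ℚ.nonNegative (nonneg μ z)}} (pointwise z)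

open import Defs
open import Data.Nat using (ℕ; _≤_; _*_; _+_)
open import Data.Integer using (+_)
open import Data.Rational using (_/_)
open import Data.Product using (Σ; ∃; _×_; _,_)
open import Relation.Binary.PropositionalEquality using (_≡_)
import Data.Nat.Properties as ℕP
open Separation using (normalising-scale; separatingPoly; separatingPoly-degree; separatingPoly-separates; separating⇒far)

theorem5p15 : (k : ℕ) → (∃ λ m → k ≡ 1 + 2 * m) → 99 ≤ k →
    (Σ (MultilinPoly k) λ Q → DegreeAtMost 4 Q × Separates (+ 1 / 225) (ThrNegHalfSqrt k) Q)
    × FarFromFourWise (+ 1 / 225) (ThrNegHalfSqrt k)
theorem5p15 k _ 99≤k =
  let r , 0≤r , 1≤ρ , ρ≤101/100 = normalising-scale k (ℕP.≤-trans (ℕP.m≤m+n 26 73) 99≤k)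
      separates = separatingPoly-separates k r 0≤r 1≤ρ ρ≤101/100
  in (separatingPoly k r , separatingPoly-degree k r , separates) ,
     separating⇒far (ℕP.≤-trans (ℕP.m≤m+n 4 95) 99≤k) (separatingPoly-degree k r) separates
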